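{- Let $G$ be a finite group such that $\mathcal{P}_e(G)$ is $2K_2$-free. Then $G$ has at most one maximal cyclic subgroup of order greater than $2$.
   Context: For a finite group $G$, the enhanced power graph $\mathcal{P}_e(G)$ is the simple graph with vertex set $G$ in which two distinct vertices $x,y$ are adjacent if and only if $\langle x,y\rangle$ is cyclic. A graph is $2K_2$-free if it has no induced subgraph isomorphic to the disjoint union of two copies of $K_2$. A maximal cyclic subgroup is a cyclic subgroup not properly contained in another cyclic subgroup. -}

module Defs where

open import Data.Nat using (ℕ; zero; suc)
open import Data.Fin using (Fin)
open import Data.Product using (Σ; ∃; _×_; _,_)
open import Relation.Binary.PropositionalEquality using (_≡_)
open import Relation.Nullary using (¬_)

-- A finite group, presented on the carrier Fin order (every finite group is
-- isomorphic to one of these), with propositional equality.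
record FiniteGroup : Set where
  field
    order : ℕ
  Carrier : Set
  Carrier = Fin order
  field
    _∙_     : Carrier → Carrier → Carrier
    ε       : Carrier
    _⁻¹     : Carrier → Carrier
    assoc   : ∀ x y z → (x ∙ y) ∙ z ≡ x ∙ (y ∙ z)
    identityˡ : ∀ x → ε ∙ x ≡ x
    identityʳ : ∀ x → x ∙ ε ≡ x
    inverseˡ : ∀ x → (x ⁻¹) ∙ x ≡ ε
    inverseʳ : ∀ x → x ∙ (x ⁻¹) ≡ ε

module _ (G : FiniteGroup) where
  open FiniteGroup G

  pow : Carrier → ℕ → Carrier
  pow g zero = ε
  pow g (suc k) = g ∙ pow g k

  -- the cyclic subgroup ⟨g⟩ (in a finite group, nonnegative powers suffice,
  -- but we include inverse powers explicitly for the literal definition)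
  data Cyc (g : Carrier) : Carrier → Set where
    pos : ∀ k → (Cyc g) (pow g k)
    neg : ∀ k → (Cyc g) (pow g k ⁻¹)

  data Gen2 (x y : Carrier) : Carrier → Set where
    gx  : Gen2 x y x
    gy  : Gen2 x y y
    gε  : Gen2 x y ε
    ginv : ∀ {a} → Gen2 x y a → Gen2 x y (a ⁻¹)
    gmul : ∀ {a b} → Gen2 x y a → Gen2 x y b → Gen2 x y (a ∙ b)

  _⊆_ : (Carrier → Set) → (Carrier → Set) → Set
  P ⊆ Q = ∀ a → P a → Q a

  _≐_ : (Carrier → Set) → (Carrier → Set) → Set
  P ≐ Q = (P ⊆ Q) × (Q ⊆ P)

  IsCyclic : (Carrier → Set) → Set
  IsCyclic H = ∃ λ z → H ≐ (Cyc z)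

  -- adjacency in the enhanced power graph
  Adj : Carrier → Carrier → Set
  Adj x y = ¬ (x ≡ y) × IsCyclic (Gen2 x y)

  TwoK2Free : Set
  TwoK2Free = ∀ a b c d →
    ¬ (a ≡ b) → ¬ (a ≡ c) → ¬ (a ≡ d) → ¬ (b ≡ c) → ¬ (b ≡ d) → ¬ (c ≡ d) →
    Adj a b → Adj c d →
    ¬ (¬ Adj a c × ¬ Adj a d × ¬ Adj b c × ¬ Adj b d)

  MaximalCyclic : Carrier → Set
  MaximalCyclic g = ∀ h → (Cyc g) ⊆ (Cyc h) → (Cyc h) ⊆ (Cyc g)

  OrderGt2 : (Carrier → Set) → Set
  OrderGt2 H = Σ Carrier λ a → Σ Carrier λ b → Σ Carrier λ c →
    H a × H b × H c × ¬ (a ≡ b) × ¬ (a ≡ c) × ¬ (b ≡ c)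

-- If h ∉ ⟨g⟩, the four elements g, g⁻¹, h, h⁻¹ induce a 2K₂ in the enhanced
-- power graph: |⟨g⟩| > 2 forces g ≠ g⁻¹, and ⟨g, g⁻¹⟩ = ⟨g⟩ is cyclic, so g ~ g⁻¹
-- (likewise h ~ h⁻¹). An edge x ~ y with x ∈ {g, g⁻¹}, y ∈ {h, h⁻¹} would make
-- ⟨x, y⟩ = ⟨z⟩ cyclic with ⟨g⟩ ⊆ ⟨z⟩, so ⟨z⟩ = ⟨g⟩ by maximality and y ∈ ⟨g⟩.
-- Hence h ∈ ⟨g⟩, and maximality of ⟨h⟩ gives ⟨g⟩ = ⟨h⟩.
module Submission where

open import Defs
open import Algebra.Bundles using (Group)
open import Data.Empty using (⊥; ⊥-elim)
open import Data.Fin using (toℕ)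
open import Data.Fin.Properties using (pigeonhole; _≟_)
open import Data.Nat using (ℕ; zero; suc; _+_; _*_; _%_; _/_)
open import Data.Nat.DivMod using (m≡m%n+[m/n]*n; m%n<n)
open import Data.Nat.Properties using (n<1+n; m≤n⇒∃[o]m+o≡n; +-suc; *-suc; anyUpTo?)
open import Data.Product using (∃; _,_)
open import Data.Sum using (_⊎_; inj₁; inj₂)
open import Function using (_∘_)
open import Level using (0ℓ)
open import Relation.Nullary using (¬_; Dec; yes; no)
open import Relation.Binary.PropositionalEquality

module _ (G : FiniteGroup) where
  open FiniteGroup G

  group : Group 0ℓ 0ℓ
  group = record
    { _≈_ = _≡_
    ; _∙_ = _∙_
    ; ε = ε
    ; _⁻¹ = _⁻¹
    ; isGroup = record
      { isMonoid = record
        { isSemigroup = record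
          { isMagma = record { isEquivalence = isEquivalence ; ∙-cong = cong₂ _∙_ }
          ; assoc = assoc
          }
        ; identity = identityˡ , identityʳ
        }
      ; inverse = inverseˡ , inverseʳ
      ; ⁻¹-cong = cong _⁻¹
      }
    }

  open import Algebra.Properties.Group group
    using (⁻¹-involutive; ε⁻¹≈ε; inverseʳ-unique; ∙-cancelˡ)
  -- k · g is the power gᵏ: the library's k-fold monoid multiple, written additively there.
  open import Algebra.Properties.Monoid.Mult (Group.monoid group)
    using (×-homo-+; ×-assocˡ) renaming (_×_ to _·_)

  pow≡· : ∀ g k → pow G g k ≡ k · g
  pow≡· g zero    = refl
  pow≡· g (suc k) = cong (g ∙_) (pow≡· g k)

  ·ε≡ε : ∀ k → k · ε ≡ ε
  ·ε≡ε zero    = refl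
  ·ε≡ε (suc k) = trans (identityˡ _) (·ε≡ε k)

  ·-multiple : ∀ {g n} → n · g ≡ ε → ∀ m → (m * n) · g ≡ ε
  ·-multiple {g} {n} gⁿ≡ε m =
    trans (sym (×-assocˡ g m n)) (trans (cong (m ·_) gⁿ≡ε) (·ε≡ε m))

  -- Two of the powers 0 · g, …, order · g coincide, and cancelling gives the period.
  ∃-period : ∀ g → ∃ λ q → suc q · g ≡ ε
  ∃-period g with pigeonhole (n<1+n order) (λ i → toℕ i · g)
  ... | i , j , i<j , gⁱ≡gʲ with m≤n⇒∃[o]m+o≡n i<j
  ... | o , 1+i+o≡j = o , ∙-cancelˡ (toℕ i · g) _ _ (begin
      (toℕ i · g) ∙ (suc o · g) ≡⟨ ×-homo-+ g (toℕ i) (suc o) ⟨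
      (toℕ i + suc o) · g       ≡⟨ cong (_· g) (trans (+-suc (toℕ i) o) 1+i+o≡j) ⟩
      toℕ j · g                 ≡⟨ gⁱ≡gʲ ⟨
      toℕ i · g                 ≡⟨ identityʳ _ ⟨
      (toℕ i · g) ∙ ε           ∎)
    where open ≡-Reasoning

  ⁻¹-power : ∀ {g q} → suc q · g ≡ ε → ∀ k → (k * q) · g ≡ (k · g) ⁻¹
  ⁻¹-power {g} {q} gᵖ≡ε k = inverseʳ-unique (k · g) ((k * q) · g) (begin
      (k · g) ∙ ((k * q) · g) ≡⟨ ×-homo-+ g k (k * q) ⟨
      (k + k * q) · g         ≡⟨ cong (_· g) (*-suc k q) ⟨
      (k * suc q) · g         ≡⟨ ·-multiple gᵖ≡ε k ⟩
      ε                       ∎)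
    where open ≡-Reasoning

  %-power : ∀ {g q} → suc q · g ≡ ε → ∀ k → (k % suc q) · g ≡ k · g
  %-power {g} {q} gᵖ≡ε k = sym (begin
      k · g                       ≡⟨ cong (_· g) (m≡m%n+[m/n]*n k (suc q)) ⟩
      (r + d * suc q) · g         ≡⟨ ×-homo-+ g r (d * suc q) ⟩
      (r · g) ∙ ((d * suc q) · g) ≡⟨ cong ((r · g) ∙_) (·-multiple gᵖ≡ε d) ⟩
      (r · g) ∙ ε                 ≡⟨ identityʳ (r · g) ⟩
      r · g                       ∎)
    where
      open ≡-Reasoning
      r d : ℕ
      r = k % suc q
      d = k / suc q

  power⇒Cyc : ∀ {g} k → Cyc G g (k · g)
  power⇒Cyc {g} k = subst (Cyc G g) (pow≡· g k) (pos k)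

  Cyc⇒power : ∀ {g a} → Cyc G g a → ∃ λ k → k · g ≡ a
  Cyc⇒power {g} (pos k) = k , sym (pow≡· g k)
  Cyc⇒power {g} (neg k) with q , gᵖ≡ε ← ∃-period g =
    k * q , trans (⁻¹-power gᵖ≡ε k) (cong _⁻¹ (sym (pow≡· g k)))

  Cyc-self : ∀ {g} → Cyc G g g
  Cyc-self {g} = subst (Cyc G g) (identityʳ g) (pos 1)

  Cyc? : ∀ g a → Dec (Cyc G g a)
  Cyc? g a with ∃-period g
  ... | q , gᵖ≡ε with anyUpTo? (λ k → k · g ≟ a) (suc q)
  ...   | yes (k , _ , k·g≡a) = yes (subst (Cyc G g) k·g≡a (power⇒Cyc k))
  ...   | no ∄k = no λ a∈⟨g⟩ → let k , k·g≡a = Cyc⇒power a∈⟨g⟩ in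
            ∄k (k % suc q , m%n<n k (suc q) , trans (%-power gᵖ≡ε k) k·g≡a)

  record IsSubgroup (H : Carrier → Set) : Set where
    field
      ε-closed  : H ε
      ∙-closed  : ∀ {a b} → H a → H b → H (a ∙ b)
      ⁻¹-closed : ∀ {a} → H a → H (a ⁻¹)

    ⁻¹-reflects : ∀ {a} → H (a ⁻¹) → H a
    ⁻¹-reflects {a} = subst H (⁻¹-involutive a) ∘ ⁻¹-closed

    pow-closed : ∀ {a} k → H a → H (pow G a k)
    pow-closed zero    _   = ε-closed
    pow-closed (suc k) a∈H = ∙-closed a∈H (pow-closed k a∈H)

    Cyc⊆ : ∀ {a} → H a → _⊆_ G (Cyc G a) H
    Cyc⊆ a∈H _ (pos k) = pow-closed k a∈H
    Cyc⊆ a∈H _ (neg k) = ⁻¹-closed (pow-closed k a∈H)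

    Gen2⊆ : ∀ {x y} → H x → H y → _⊆_ G (Gen2 G x y) H
    Gen2⊆ x∈H y∈H _ gx         = x∈H
    Gen2⊆ x∈H y∈H _ gy         = y∈H
    Gen2⊆ x∈H y∈H _ gε         = ε-closed
    Gen2⊆ x∈H y∈H _ (ginv p)   = ⁻¹-closed (Gen2⊆ x∈H y∈H _ p)
    Gen2⊆ x∈H y∈H _ (gmul p q) = ∙-closed (Gen2⊆ x∈H y∈H _ p) (Gen2⊆ x∈H y∈H _ q)

  open IsSubgroup

  Gen2-isSubgroup : ∀ {x y} → IsSubgroup (Gen2 G x y)
  Gen2-isSubgroup = record { ε-closed = gε ; ∙-closed = gmul ; ⁻¹-closed = ginv }

  Cyc-isSubgroup : ∀ g → IsSubgroup (Cyc G g)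
  Cyc-isSubgroup g = record
    { ε-closed  = pos 0
    ; ∙-closed  = ∙-closed′
    ; ⁻¹-closed = ⁻¹-closed′
    }
    where
      ∙-closed′ : ∀ {a b} → Cyc G g a → Cyc G g b → Cyc G g (a ∙ b)
      ∙-closed′ a∈ b∈ with Cyc⇒power a∈ | Cyc⇒power b∈
      ... | m , refl | n , refl = subst (Cyc G g) (×-homo-+ g m n) (power⇒Cyc (m + n))

      ⁻¹-closed′ : ∀ {a} → Cyc G g a → Cyc G g (a ⁻¹)
      ⁻¹-closed′ a∈ with Cyc⇒power a∈
      ... | k , refl = subst (Cyc G g) (cong _⁻¹ (pow≡· g k)) (neg k)

  pair-isSubgroup : ∀ {g} → g ⁻¹ ≡ g → IsSubgroup (λ a → a ≡ ε ⊎ a ≡ g)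
  pair-isSubgroup {g} g⁻¹≡g = record
    { ε-closed  = inj₁ refl
    ; ∙-closed  = ∙-closed′
    ; ⁻¹-closed = λ { (inj₁ refl) → inj₁ ε⁻¹≈ε ; (inj₂ refl) → inj₂ g⁻¹≡g }
    }
    where
      ∙-closed′ : ∀ {a b} → a ≡ ε ⊎ a ≡ g → b ≡ ε ⊎ b ≡ g → a ∙ b ≡ ε ⊎ a ∙ b ≡ g
      ∙-closed′ (inj₁ refl) (inj₁ refl) = inj₁ (identityˡ ε)
      ∙-closed′ (inj₁ refl) (inj₂ refl) = inj₂ (identityˡ g)
      ∙-closed′ (inj₂ refl) (inj₁ refl) = inj₂ (identityʳ g)
      ∙-closed′ (inj₂ refl) (inj₂ refl) = inj₁ (trans (cong (g ∙_) (sym g⁻¹≡g)) (inverseʳ g))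

  ¬OrderGt2-pair : ∀ {H u v} → _⊆_ G H (λ a → a ≡ u ⊎ a ≡ v) → ¬ OrderGt2 G H
  ¬OrderGt2-pair {u = u} {v} H⊆ (a , b , c , a∈ , b∈ , c∈ , a≢b , a≢c , b≢c) =
    distinct (H⊆ a a∈) (H⊆ b b∈) (H⊆ c c∈)
    where
      distinct : a ≡ u ⊎ a ≡ v → b ≡ u ⊎ b ≡ v → c ≡ u ⊎ c ≡ v → ⊥
      distinct (inj₁ a≡u) (inj₁ b≡u) _          = a≢b (trans a≡u (sym b≡u))
      distinct (inj₂ a≡v) (inj₂ b≡v) _          = a≢b (trans a≡v (sym b≡v))
      distinct (inj₁ a≡u) _          (inj₁ c≡u) = a≢c (trans a≡u (sym c≡u))
      distinct (inj₂ a≡v) _          (inj₂ c≡v) = a≢c (trans a≡v (sym c≡v))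
      distinct _          (inj₁ b≡u) (inj₁ c≡u) = b≢c (trans b≡u (sym c≡u))
      distinct _          (inj₂ b≡v) (inj₂ c≡v) = b≢c (trans b≡v (sym c≡v))

  OrderGt2⇒≢⁻¹ : ∀ {g} → OrderGt2 G (Cyc G g) → ¬ g ≡ g ⁻¹
  OrderGt2⇒≢⁻¹ big g≡g⁻¹ =
    ¬OrderGt2-pair (Cyc⊆ (pair-isSubgroup (sym g≡g⁻¹)) (inj₂ refl)) big

  Adj-⁻¹ : ∀ {g} → OrderGt2 G (Cyc G g) → Adj G g (g ⁻¹)
  Adj-⁻¹ {g} big =
    OrderGt2⇒≢⁻¹ big ,
    g ,
    Gen2⊆ (Cyc-isSubgroup g) Cyc-self (⁻¹-closed (Cyc-isSubgroup g) Cyc-self) ,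
    Cyc⊆ Gen2-isSubgroup gx

  maximal-absorbs : ∀ {g x y} → MaximalCyclic G g → Gen2 G x y g →
                    IsCyclic G (Gen2 G x y) → _⊆_ G (Gen2 G x y) (Cyc G g)
  maximal-absorbs mg g∈ (z , ⟨x,y⟩⊆⟨z⟩ , _) a a∈ =
    mg z (λ b → ⟨x,y⟩⊆⟨z⟩ b ∘ Cyc⊆ Gen2-isSubgroup g∈ b) a (⟨x,y⟩⊆⟨z⟩ a a∈)

  ¬Adj-outside : ∀ {g x y} → MaximalCyclic G g → Gen2 G x y g → ¬ Cyc G g y → ¬ Adj G x y
  ¬Adj-outside mg g∈ y∉⟨g⟩ (_ , cyclic) = y∉⟨g⟩ (maximal-absorbs mg g∈ cyclic _ gy)

  maximal-⊇⇒≐ : ∀ {g h} → MaximalCyclic G h → Cyc G g h → _≐_ G (Cyc G g) (Cyc G h)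
  maximal-⊇⇒≐ {g} {h} mh h∈⟨g⟩ = mh g ⟨h⟩⊆⟨g⟩ , ⟨h⟩⊆⟨g⟩
    where
      ⟨h⟩⊆⟨g⟩ : _⊆_ G (Cyc G h) (Cyc G g)
      ⟨h⟩⊆⟨g⟩ = Cyc⊆ (Cyc-isSubgroup g) h∈⟨g⟩

  outside⇒¬TwoK2Free : ∀ {g h} → MaximalCyclic G g → OrderGt2 G (Cyc G g) →
                       OrderGt2 G (Cyc G h) → ¬ Cyc G g h → ¬ TwoK2Free G
  outside⇒¬TwoK2Free {g} {h} mg big-g big-h h∉ free =
    free g (g ⁻¹) h (h ⁻¹)
      (OrderGt2⇒≢⁻¹ big-g) (separate g∈ h∉) (separate g∈ h⁻¹∉) (separate g⁻¹∈ h∉)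
      (separate g⁻¹∈ h⁻¹∉) (OrderGt2⇒≢⁻¹ big-h)
      (Adj-⁻¹ big-g) (Adj-⁻¹ big-h)
      ( ¬Adj-outside mg gx h∉ , ¬Adj-outside mg gx h⁻¹∉
      , ¬Adj-outside mg g∈⟨g⁻¹,y⟩ h∉ , ¬Adj-outside mg g∈⟨g⁻¹,y⟩ h⁻¹∉ )
    where
      separate : ∀ {x y} → Cyc G g x → ¬ Cyc G g y → ¬ x ≡ y
      separate x∈ y∉ refl = y∉ x∈

      g∈ : Cyc G g g
      g∈ = Cyc-self

      g⁻¹∈ : Cyc G g (g ⁻¹)
      g⁻¹∈ = ⁻¹-closed (Cyc-isSubgroup g) g∈

      h⁻¹∉ : ¬ Cyc G g (h ⁻¹)
      h⁻¹∉ = h∉ ∘ ⁻¹-reflects (Cyc-isSubgroup g)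

      g∈⟨g⁻¹,y⟩ : ∀ {y} → Gen2 G (g ⁻¹) y g
      g∈⟨g⁻¹,y⟩ = ⁻¹-reflects Gen2-isSubgroup gx

lemma3p1 : (G : FiniteGroup) → TwoK2Free G →
    ∀ g h → MaximalCyclic G g → OrderGt2 G (Cyc G g) →
    MaximalCyclic G h → OrderGt2 G (Cyc G h) →
    _≐_ G (Cyc G g) (Cyc G h)
lemma3p1 G free g h mg big-g mh big-h with Cyc? G g h
... | yes h∈⟨g⟩ = maximal-⊇⇒≐ G mh h∈⟨g⟩
... | no  h∉⟨g⟩ = ⊥-elim (outside⇒¬TwoK2Free G mg big-g big-h h∉⟨g⟩ free)
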